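{- Let $K=C_m\oplus C_m$ with $m\ge4$, let $g\in K$, let $f_1,f_2\in K$, and suppose $S=f_1^{m-1}f_2^{m-1}(f_1+f_2)\in\Upsilon_{nu}(K)$. (1) If $S'=f_1^{ -2}S(f_1+g)(f_1-g)\in\Upsilon(K)$, then $g\in\langle f_2\rangle$. (2) If $S'=f_2^{ -2}S(f_2+g)(f_2-g)\in\Upsilon(K)$, then $g\in\langle f_1\rangle$. (3) If $S'=f_1^{ -1}f_2^{ -1}S(f_1+g)(f_2-g)\in\Upsilon(K)$, then $S=S'$ and $g\in\{0,-f_1+f_2\}$. (4) If $S'=f_1^{ -1}(f_1+f_2)^{ -1}S(f_1+g)(f_1+f_2-g)\in\Upsilon(K)$, then $g\in\langle f_2\rangle$. (5) If $S'=f_2^{ -1}(f_1+f_2)^{ -1}S(f_2+g)(f_1+f_2-g)\in\Upsilon(K)$, then $g\in\langle f_1\rangle$.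
   Context: A sequence over an abelian group $K$ is a finite unordered sequence of elements of $K$, i.e. an element of the free abelian monoid on $K$, written multiplicatively ($h^k$ is $k$ copies of $h$; products are concatenations). For a subsequence $T$ of $S$, $T^{ -1}S$ denotes $S$ with the terms of $T$ removed; e.g. $f_1^{ -2}S(f_1+g)(f_1-g)$ is obtained from $S$ by removing two copies of $f_1$ and adding $f_1+g$ and $f_1-g$. A minimal zero-sum sequence is a nonempty sequence with sum $0$ having no nonempty proper subsequence with sum $0$. $\Upsilon(K)$ is the set of minimal zero-sum sequences $S$ over $K=C_m\oplus C_m$ for which there exist a basis $(e_1,e_2)$ of $K$ (i.e. $K=\langle e_1\rangle\oplus\langle e_2\rangle$, $e_1,e_2\neq0$) and integers $y_1,\dots,y_m\in[0,m-1]$ with $y_1+\dots+y_m\equiv1\pmod m$ such that $S=e_1^{m-1}\prod_{\nu=1}^m(y_\nu e_1+e_2)$. $\Upsilon_u(K)$ is the set of $S\in\Upsilon(K)$ having a unique element of multiplicity $m-1$, and $\Upsilon_{nu}(K)=\Upsilon(K)\setminus\Upsilon_u(K)$. -}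

module Defs where

open import Data.Nat using (ℕ; zero; suc; _+_; _*_; _∸_; _≤_; _<_; NonZero)
open import Data.Nat.DivMod using (_mod_)
open import Data.Fin using (Fin; toℕ)
open import Data.Fin.Properties using () renaming (_≟_ to _≟F_)
open import Data.Product using (_×_; _,_; Σ; ∃; ∃-syntax)
open import Data.Product.Properties using (≡-dec)
open import Data.List using (List; []; _∷_; _++_; foldr; length; replicate; map; filter; allFin)
open import Data.List.Relation.Binary.Sublist.Propositional using (_⊆_)
open import Data.List.Relation.Binary.Permutation.Propositional using (_↭_)
open import Relation.Binary.PropositionalEquality using (_≡_; _≢_)
open import Relation.Nullary using (¬_; Dec)

K : (m : ℕ) → Set
K m = Fin m × Fin m

module _ (m : ℕ) .{{_ : NonZero m}} where

  _≟K_ : (x y : K m) → Dec (x ≡ y)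
  _≟K_ = ≡-dec _≟F_ _≟F_

  0K : K m
  0K = (0 mod m , 0 mod m)

  infixl 6 _+K_
  _+K_ : K m → K m → K m
  (a , b) +K (c , d) = ((toℕ a + toℕ c) mod m , (toℕ b + toℕ d) mod m)

  -K_ : K m → K m
  -K (a , b) = ((m ∸ toℕ a) mod m , (m ∸ toℕ b) mod m)

  infixl 6 _-K_
  _-K_ : K m → K m → K m
  x -K y = x +K (-K y)

  infixl 7 _·K_
  _·K_ : ℕ → K m → K m
  k ·K (a , b) = ((k * toℕ a) mod m , (k * toℕ b) mod m)

  _∈⟨_⟩ : K m → K m → Set
  g ∈⟨ f ⟩ = ∃[ k ] g ≡ k ·K f

  -- Sequences over K: finite lists, considered up to permutation (_↭_).
  Seq : Set
  Seq = List (K m)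

  σ : Seq → K m
  σ = foldr _+K_ 0K

  count : K m → Seq → ℕ
  count h S = length (filter (λ x → x ≟K h) S)

  -- minimal zero-sum sequence: nonempty, sum 0, and no nonempty proper
  -- subsequence (sub-multiset = sublist) has sum 0
  MinZeroSum : Seq → Set
  MinZeroSum S = (S ≢ []) × (σ S ≡ 0K)
    × (∀ T → T ⊆ S → T ≢ [] → length T < length S → σ T ≢ 0K)

  IsBasis : K m → K m → Set
  IsBasis e1 e2 = (e1 ≢ 0K) × (e2 ≢ 0K)
    × (∀ x → ∃[ a ] ∃[ b ] x ≡ a ·K e1 +K b ·K e2)
    × (∀ a b → a ·K e1 ≡ b ·K e2 → a ·K e1 ≡ 0K)

  sumFin : (Fin m → Fin m) → ℕ
  sumFin y = foldr _+_ 0 (map (λ ν → toℕ (y ν)) (allFin m))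

  Υ : Seq → Set
  Υ S = MinZeroSum S ×
    (∃[ e1 ] ∃[ e2 ] IsBasis e1 e2 × (Σ (Fin m → Fin m) λ y →
       (sumFin y mod m ≡ 1 mod m) ×
       (S ↭ (replicate (m ∸ 1) e1 ++ map (λ ν → toℕ (y ν) ·K e1 +K e2) (allFin m)))))

  UniqueMult : Seq → Set
  UniqueMult S = ∃[ h ] (count h S ≡ m ∸ 1) × (∀ h' → count h' S ≡ m ∸ 1 → h' ≡ h)

  Υu : Seq → Set
  Υu S = Υ S × UniqueMult S

  Υnu : Seq → Set
  Υnu S = Υ S × ¬ UniqueMult S

{-# OPTIONS --safe #-}
module Submission where

-- Every sequence in Υ has the form e^(m-1) T with e ≠ 0 and all terms of T in one coset
-- c + ⟨e⟩ not containing e (because e₂ ∉ ⟨e₁⟩).  Applied to S this makes f₁, f₂ distinct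
-- and nonzero.  In a perturbed sequence S′ the element e must occur exactly m - 1 ≥ 3
-- times, and comparing multiplicities leaves three cases: e = f₁, e = f₂, or every new term
-- equals e (possible only for a tail of three terms and m = 4).  Either g is then read off
-- from an equation between two terms, or x and x + g are both terms of S′ other than e, so
-- that g = (x + g) - x lies in ⟨e⟩.

open import Defs
open import Level using (0ℓ)
open import Algebra.Bundles using (AbelianGroup; Group)
open import Algebra.Structures using (IsAbelianGroup)
import Algebra.Properties.Group as GroupProperties
import Algebra.Properties.AbelianGroup as AbelianGroupProperties
import Algebra.Properties.CommutativeSemigroup as CommutativeSemigroupProperties
open import Algebra.Consequences.Propositional using (comm∧idʳ⇒id; comm∧invʳ⇒inv)
open import Data.Nat using (ℕ; suc; _+_; _*_; _∸_; _≤_; NonZero; _%_; z≤n; s≤s; >-nonZero⁻¹)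
open import Data.Nat.Properties
  using (+-comm; +-assoc; +-identityʳ; +-cancelˡ-≡; *-identityˡ; *-identityʳ; *-distribʳ-+; *-distribˡ-+; *-assoc; *-comm; m+[n∸m]≡n; <⇒≤; <⇒≢; ≤-antisym; 1+n≢0; ≤⇒≯; m≤m+n)
open import Data.Nat.DivMod using (_mod_; m%n<n; m%n%n≡m%n; %-distribˡ-+; m<n⇒m%n≡m; m*n%n≡0)
open import Data.Fin using (Fin; toℕ)
open import Data.Fin.Properties using (toℕ-injective; toℕ<n; toℕ-fromℕ<)
open import Data.Product using (_×_; _,_; ∃; ∃-syntax; <_,_>)
open import Data.Sum using (_⊎_; inj₁; inj₂)
open import Data.Empty using (⊥-elim)
open import Data.List using (List; []; _∷_; _++_; [_]; length; replicate; map; filter; allFin)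
open import Data.List.Properties using (++-assoc; filter-++; length-++; length-filter; filter-all; filter-complete; filter-some; filter-none; length-replicate)
open import Data.List.Relation.Unary.All as All using (All; []; _∷_)
open import Data.List.Relation.Unary.All.Properties using (all-filter; replicate⁺)
open import Data.List.Relation.Unary.Any as Any using (here; there)
open import Data.List.Membership.Propositional using (_∈_; _∉_)
open import Data.List.Membership.Propositional.Properties using (∈-++⁻; ∈-++⁺ʳ; ∈-map⁻)
open import Data.List.Relation.Binary.Permutation.Propositional using (_↭_; ↭-refl; ↭-sym; ↭-trans; ↭-reflexive; prep; swap; module PermutationReasoning)
open import Data.List.Relation.Binary.Permutation.Propositional.Properties using (filter-↭; ↭-length; ∈-resp-↭; shift; shifts; ++⁺ˡ; ++-comm)
open import Relation.Binary.PropositionalEquality using (_≡_; _≢_; ≢-sym; refl; sym; trans; cong; cong₂; subst; isEquivalence; module ≡-Reasoning)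
open import Relation.Nullary using (¬_; yes; no)
open import Function using (_∘_; id)

module Division {g ℓ} (G : Group g ℓ) where

  open Group G using (_≈_; _∙_; _//_; _\\_; ε; setoid; ∙-congʳ; inverseˡ)
  open GroupProperties G using (y≈x\\z; //-rightDividesˡ)
  open import Relation.Binary.Reasoning.Setoid setoid

  x≈z//y⇒y≈x\\z : ∀ {x y z} → x ≈ z // y → y ≈ x \\ z
  x≈z//y⇒y≈x\\z {x} {y} {z} x≈z//y = y≈x\\z x y z (begin
    x ∙ y         ≈⟨ ∙-congʳ x≈z//y ⟩
    (z // y) ∙ y  ≈⟨ //-rightDividesˡ y z ⟩
    z             ∎)

  x≈x//y⇒y≈ε : ∀ {x y} → x ≈ x // y → y ≈ ε
  x≈x//y⇒y≈ε {x} {y} x≈x//y = begin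
    y       ≈⟨ x≈z//y⇒y≈x\\z x≈x//y ⟩
    x \\ x  ≈⟨ inverseˡ x ⟩
    ε       ∎

module CosetDifference {g ℓ} (G : AbelianGroup g ℓ) where

  open AbelianGroup G using (_≈_; _∙_; _⁻¹; setoid; ∙-congʳ; commutativeSemigroup)
  open AbelianGroupProperties G using (y≈x\\z; ∙-cancelʳ)
  open CommutativeSemigroupProperties commutativeSemigroup using (xy∙z≈xz∙y)
  open import Relation.Binary.Reasoning.Setoid setoid

  coset-difference : ∀ {a b c x y} → x ≈ a ∙ c → x ∙ y ≈ b ∙ c → y ≈ a ⁻¹ ∙ b
  coset-difference {a} {b} {c} {x} {y} x≈a∙c x∙y≈b∙c = y≈x\\z a y b (∙-cancelʳ c (a ∙ y) b (begin
    a ∙ y ∙ c  ≈⟨ xy∙z≈xz∙y a y c ⟩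
    a ∙ c ∙ y  ≈⟨ ∙-congʳ x≈a∙c ⟨
    x ∙ y      ≈⟨ x∙y≈b∙c ⟩
    b ∙ c      ∎))

↭-heads-to-end : ∀ {a} {A : Set a} (xs ys : List A) (s x y : A) →
                 x ∷ xs ++ y ∷ ys ++ [ s ] ↭ xs ++ ys ++ s ∷ x ∷ y ∷ []
↭-heads-to-end xs ys s x y = begin
  x ∷ xs ++ y ∷ ys ++ [ s ]         ↭⟨ shift x xs (y ∷ ys ++ [ s ]) ⟨
  xs ++ x ∷ y ∷ ys ++ [ s ]         ↭⟨ ++⁺ˡ xs (++-comm (x ∷ y ∷ []) (ys ++ [ s ])) ⟩
  xs ++ (ys ++ [ s ]) ++ x ∷ y ∷ [] ≡⟨ cong (xs ++_) (++-assoc ys [ s ] (x ∷ y ∷ [])) ⟩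
  xs ++ ys ++ s ∷ x ∷ y ∷ []        ∎
  where open PermutationReasoning

module KGroup (m : ℕ) .{{_ : NonZero m}} where

  private
    ⟦_⟧ : ℕ → Fin m
    ⟦ a ⟧ = a mod m

    toℕ-⟦⟧ : ∀ a → toℕ ⟦ a ⟧ ≡ a % m
    toℕ-⟦⟧ a = toℕ-fromℕ< (m%n<n a m)

    ⟦⟧-cong : ∀ {a b} → a % m ≡ b % m → ⟦ a ⟧ ≡ ⟦ b ⟧
    ⟦⟧-cong {a} {b} eq = toℕ-injective (trans (toℕ-⟦⟧ a) (trans eq (sym (toℕ-⟦⟧ b))))

    ⟦toℕ⟧ : ∀ (i : Fin m) → ⟦ toℕ i ⟧ ≡ i
    ⟦toℕ⟧ i = toℕ-injective (trans (toℕ-⟦⟧ (toℕ i)) (m<n⇒m%n≡m (toℕ<n i)))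

    ⟦⟧-absorbˡ : ∀ a b → ⟦ toℕ ⟦ a ⟧ + b ⟧ ≡ ⟦ a + b ⟧
    ⟦⟧-absorbˡ a b = ⟦⟧-cong (begin
      (toℕ ⟦ a ⟧ + b) % m          ≡⟨ %-distribˡ-+ (toℕ ⟦ a ⟧) b m ⟩
      (toℕ ⟦ a ⟧ % m + b % m) % m  ≡⟨ cong (λ r → (r % m + b % m) % m) (toℕ-⟦⟧ a) ⟩
      (a % m % m + b % m) % m      ≡⟨ cong (λ r → (r + b % m) % m) (m%n%n≡m%n a m) ⟩
      (a % m + b % m) % m          ≡⟨ %-distribˡ-+ a b m ⟨
      (a + b) % m                  ∎)
      where open ≡-Reasoning

    ⟦⟧-absorbʳ : ∀ a b → ⟦ a + toℕ ⟦ b ⟧ ⟧ ≡ ⟦ a + b ⟧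
    ⟦⟧-absorbʳ a b = trans (cong ⟦_⟧ (+-comm a _)) (trans (⟦⟧-absorbˡ b a) (cong ⟦_⟧ (+-comm b a)))

    ⟦⟧-absorb : ∀ a b → ⟦ toℕ ⟦ a ⟧ + toℕ ⟦ b ⟧ ⟧ ≡ ⟦ a + b ⟧
    ⟦⟧-absorb a b = trans (⟦⟧-absorbˡ a _) (⟦⟧-absorbʳ a b)

    ⟦*m⟧≡⟦0⟧ : ∀ a → ⟦ a * m ⟧ ≡ ⟦ 0 ⟧
    ⟦*m⟧≡⟦0⟧ a = ⟦⟧-cong (trans (m*n%n≡0 a m) (sym (m<n⇒m%n≡m (>-nonZero⁻¹ m))))

  infixl 6 _∙_
  _∙_ : K m → K m → K m
  _∙_ = _+K_ m

  infixl 7 _·_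
  _·_ : ℕ → K m → K m
  _·_ = _·K_ m

  ∙-comm : ∀ x y → x ∙ y ≡ y ∙ x
  ∙-comm (a , a′) (b , b′) = cong₂ _,_ (cong ⟦_⟧ (+-comm (toℕ a) (toℕ b))) (cong ⟦_⟧ (+-comm (toℕ a′) (toℕ b′)))

  ∙-assoc : ∀ x y z → x ∙ y ∙ z ≡ x ∙ (y ∙ z)
  ∙-assoc (a , a′) (b , b′) (c , c′) = cong₂ _,_ (assoc (toℕ a) (toℕ b) (toℕ c)) (assoc (toℕ a′) (toℕ b′) (toℕ c′))
    where
    assoc : ∀ i j k → ⟦ toℕ ⟦ i + j ⟧ + k ⟧ ≡ ⟦ i + toℕ ⟦ j + k ⟧ ⟧
    assoc i j k = trans (⟦⟧-absorbˡ (i + j) k) (trans (cong ⟦_⟧ (+-assoc i j k)) (sym (⟦⟧-absorbʳ i (j + k))))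

  ∙-identityʳ : ∀ x → x ∙ 0K m ≡ x
  ∙-identityʳ (a , a′) = cong₂ _,_ (identityʳ a) (identityʳ a′)
    where
    identityʳ : ∀ i → ⟦ toℕ i + toℕ ⟦ 0 ⟧ ⟧ ≡ i
    identityʳ i = trans (⟦⟧-absorbʳ (toℕ i) 0) (trans (cong ⟦_⟧ (+-identityʳ (toℕ i))) (⟦toℕ⟧ i))

  ∙-inverseʳ : ∀ x → x ∙ -K_ m x ≡ 0K m
  ∙-inverseʳ (a , a′) = cong₂ _,_ (inverseʳ a) (inverseʳ a′)
    where
    inverseʳ : ∀ i → ⟦ toℕ i + toℕ ⟦ m ∸ toℕ i ⟧ ⟧ ≡ ⟦ 0 ⟧
    inverseʳ i = trans (⟦⟧-absorbʳ (toℕ i) _)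
      (trans (cong ⟦_⟧ (m+[n∸m]≡n (<⇒≤ (toℕ<n i)))) (trans (cong ⟦_⟧ (sym (*-identityˡ m))) (⟦*m⟧≡⟦0⟧ 1)))

  isAbelianGroup : IsAbelianGroup _≡_ _∙_ (0K m) (-K_ m)
  isAbelianGroup = record
    { isGroup = record
      { isMonoid = record
        { isSemigroup = record { isMagma = record { isEquivalence = isEquivalence ; ∙-cong = cong₂ _∙_ } ; assoc = ∙-assoc }
        ; identity = comm∧idʳ⇒id ∙-comm ∙-identityʳ
        }
      ; inverse = comm∧invʳ⇒inv ∙-comm ∙-inverseʳ
      ; ⁻¹-cong = cong (-K_ m)
      }
    ; comm = ∙-comm
    }

  abelianGroup : AbelianGroup 0ℓ 0ℓ
  abelianGroup = record { isAbelianGroup = isAbelianGroup }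

  ·-identityˡ : ∀ x → 1 · x ≡ x
  ·-identityˡ (a , a′) = cong₂ _,_ (one a) (one a′)
    where
    one : ∀ i → ⟦ 1 * toℕ i ⟧ ≡ i
    one i = trans (cong ⟦_⟧ (*-identityˡ (toℕ i))) (⟦toℕ⟧ i)

  ·-distribʳ-+ : ∀ k j x → k · x ∙ j · x ≡ (k + j) · x
  ·-distribʳ-+ k j (a , a′) = cong₂ _,_ (distrib (toℕ a)) (distrib (toℕ a′))
    where
    distrib : ∀ i → ⟦ toℕ ⟦ k * i ⟧ + toℕ ⟦ j * i ⟧ ⟧ ≡ ⟦ (k + j) * i ⟧
    distrib i = trans (⟦⟧-absorb (k * i) (j * i)) (cong ⟦_⟧ (sym (*-distribʳ-+ i k j)))

  ·-annihilated-by-m : ∀ k x → (k * m) · x ≡ 0K m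
  ·-annihilated-by-m k (a , a′) = cong₂ _,_ (annihilate (toℕ a)) (annihilate (toℕ a′))
    where
    annihilate : ∀ i → ⟦ k * m * i ⟧ ≡ ⟦ 0 ⟧
    annihilate i = trans (cong ⟦_⟧ (trans (*-assoc k m i) (trans (cong (k *_) (*-comm m i)) (sym (*-assoc k i m)))))
                     (⟦*m⟧≡⟦0⟧ (k * i))

  open AbelianGroup abelianGroup public using (ε; _⁻¹; _-_; group)
  open AbelianGroupProperties abelianGroup using (inverseʳ-unique)

  ε∈⟨⟩ : ∀ {f} → _∈⟨_⟩ m ε f
  ε∈⟨⟩ {_ , _} = 0 , refl

  x∈⟨x⟩ : ∀ {x} → _∈⟨_⟩ m x x
  x∈⟨x⟩ {x} = 1 , sym (·-identityˡ x)

  ∈⟨⟩-∙ : ∀ {f x y} → _∈⟨_⟩ m x f → _∈⟨_⟩ m y f → _∈⟨_⟩ m (x ∙ y) f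
  ∈⟨⟩-∙ {f} (k , refl) (j , refl) = k + j , ·-distribʳ-+ k j f

  ∈⟨⟩-⁻¹ : ∀ {f x} → _∈⟨_⟩ m x f → _∈⟨_⟩ m (x ⁻¹) f
  ∈⟨⟩-⁻¹ {f} (k , refl) = k * (m ∸ 1) , sym (inverseʳ-unique (k · f) ((k * (m ∸ 1)) · f) (begin
    k · f ∙ (k * (m ∸ 1)) · f  ≡⟨ ·-distribʳ-+ k (k * (m ∸ 1)) f ⟩
    (k + k * (m ∸ 1)) · f      ≡⟨ cong (_· f) k+k*[m∸1]≡k*m ⟩
    (k * m) · f                ≡⟨ ·-annihilated-by-m k f ⟩
    ε                          ∎))
    where
    open ≡-Reasoning
    k+k*[m∸1]≡k*m : k + k * (m ∸ 1) ≡ k * m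
    k+k*[m∸1]≡k*m = trans (cong (_+ k * (m ∸ 1)) (sym (*-identityʳ k)))
                      (trans (sym (*-distribˡ-+ k 1 (m ∸ 1))) (cong (k *_) (m+[n∸m]≡n (>-nonZero⁻¹ m))))

  second∉⟨first⟩ : ∀ {e₁ e₂} → IsBasis m e₁ e₂ → ¬ _∈⟨_⟩ m e₂ e₁
  second∉⟨first⟩ {e₂ = e₂} (_ , e₂≢ε , _ , independent) (t , e₂≡t·e₁) =
    e₂≢ε (trans e₂≡t·e₁ (independent t 1 (trans (sym e₂≡t·e₁) (sym (·-identityˡ e₂)))))

module KSequences (m : ℕ) .{{_ : NonZero m}} where

  open KGroup m
  open AbelianGroupProperties abelianGroup using (y≈x\\z)
  open CosetDifference abelianGroup

  count-++ : ∀ h L L′ → count m h (L ++ L′) ≡ count m h L + count m h L′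
  count-++ h L L′ = trans (cong length (filter-++ (λ x → _≟K_ m x h) L L′)) (length-++ (filter (λ x → _≟K_ m x h) L))

  count-↭ : ∀ {h L L′} → L ↭ L′ → count m h L ≡ count m h L′
  count-↭ {h} L↭L′ = ↭-length (filter-↭ (λ x → _≟K_ m x h) L↭L′)

  count≤length : ∀ h L → count m h L ≤ length L
  count≤length h = length-filter (λ x → _≟K_ m x h)

  count≡0⇒∉ : ∀ {h L} → count m h L ≡ 0 → h ∉ L
  count≡0⇒∉ {h} count≡0 h∈L = <⇒≢ (filter-some (λ x → _≟K_ m x h) (Any.map sym h∈L)) (sym count≡0)

  ∉⇒count≡0 : ∀ {h L} → h ∉ L → count m h L ≡ 0
  ∉⇒count≡0 {h} h∉L =
    cong length (filter-none (λ x → _≟K_ m x h) (All.tabulate λ x∈L x≡h → h∉L (subst (_∈ _) x≡h x∈L)))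

  count≡suc⇒∈ : ∀ {h L k} → count m h L ≡ suc k → h ∈ L
  count≡suc⇒∈ {h} {x ∷ L} count≡suc with _≟K_ m x h
  ... | yes x≡h = here (sym x≡h)
  ... | no _    = there (count≡suc⇒∈ count≡suc)

  count≥length⇒All≡ : ∀ {h L} → length L ≤ count m h L → All (_≡ h) L
  count≥length⇒All≡ {h} {L} length≤count =
    subst (All (_≡ h)) (filter-complete P? (≤-antisym (count≤length h L) length≤count)) (all-filter P? L)
    where
    P? = λ x → _≟K_ m x h

  count-replicate-self : ∀ k x → count m x (replicate k x) ≡ k
  count-replicate-self k x = trans (cong length (filter-all (λ y → _≟K_ m y x) (replicate⁺ k refl))) (length-replicate k)

  count-replicate-other : ∀ {x h} k → x ≢ h → count m h (replicate k x) ≡ 0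
  count-replicate-other {x} k x≢h = ∉⇒count≡0 λ h∈ → x≢h (sym (All.lookup (replicate⁺ {P = _≡ x} k refl) h∈))

  count-replicate-++ : ∀ a x L → count m x (replicate a x ++ L) ≡ a + count m x L
  count-replicate-++ a x L = trans (count-++ x (replicate a x) L) (cong (_+ count m x L) (count-replicate-self a x))

  count-replicate-other-++ : ∀ {x h} a L → x ≢ h → count m h (replicate a x ++ L) ≡ count m h L
  count-replicate-other-++ {x} {h} a L x≢h =
    trans (count-++ h (replicate a x) L) (cong (_+ count m h L) (count-replicate-other a x≢h))

  -- Counts are written r + a rather than a + r: with m = 4 + n the equation count-e then
  -- matches definitionally, since e.g. m ∸ 1 and 2 + (m ∸ 3) have the same normal form.
  module _ (a b : ℕ) {x y : K m} {L : Seq m} where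

    count-in-first-block : ∀ r → y ≢ x → count m x (replicate a x ++ replicate b y ++ L) ≡ r + a → count m x L ≡ r
    count-in-first-block r y≢x eq = +-cancelˡ-≡ a _ _ (begin
      a + count m x L                                 ≡⟨ cong (a +_) (count-replicate-other-++ b L y≢x) ⟨
      a + count m x (replicate b y ++ L)              ≡⟨ count-replicate-++ a x _ ⟨
      count m x (replicate a x ++ replicate b y ++ L) ≡⟨ eq ⟩
      r + a                                           ≡⟨ +-comm r a ⟩
      a + r                                           ∎)
      where open ≡-Reasoning

    count-in-second-block : ∀ r → x ≢ y → count m y (replicate a x ++ replicate b y ++ L) ≡ r + b → count m y L ≡ r
    count-in-second-block r x≢y eq = +-cancelˡ-≡ b _ _ (begin
      b + count m y L                                 ≡⟨ count-replicate-++ b y L ⟨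
      count m y (replicate b y ++ L)                  ≡⟨ count-replicate-other-++ a _ x≢y ⟨
      count m y (replicate a x ++ replicate b y ++ L) ≡⟨ eq ⟩
      r + b                                           ≡⟨ +-comm r b ⟩
      b + r                                           ∎)
      where open ≡-Reasoning

    count-outside-blocks : ∀ {h k} → x ≢ h → y ≢ h → count m h (replicate a x ++ replicate b y ++ L) ≡ k → count m h L ≡ k
    count-outside-blocks x≢h y≢h eq =
      trans (sym (trans (count-replicate-other-++ a _ x≢h) (count-replicate-other-++ b L y≢h))) eq

    ∈-beyond-blocks : ∀ {z} → z ∈ L → z ∈ replicate a x ++ replicate b y ++ L
    ∈-beyond-blocks z∈L = ∈-++⁺ʳ (replicate a x) (∈-++⁺ʳ (replicate b y) z∈L)

  record CosetForm (T : Seq m) (e : K m) : Set where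
    field
      c        : K m
      e≢ε      : e ≢ ε
      count-e  : count m e T ≡ m ∸ 1
      in-coset : ∀ {x} → x ∈ T → x ≢ e → ∃[ k ] x ≡ k · e ∙ c

  CosetForm-resp-↭ : ∀ {T T′ e} → T ↭ T′ → CosetForm T e → CosetForm T′ e
  CosetForm-resp-↭ T↭T′ form = record
    { c        = c
    ; e≢ε      = e≢ε
    ; count-e  = trans (sym (count-↭ T↭T′)) count-e
    ; in-coset = λ x∈T′ → in-coset (∈-resp-↭ (↭-sym T↭T′) x∈T′)
    }
    where open CosetForm form

  Υ⇒CosetForm : ∀ {T} → Υ m T → ∃ (CosetForm T)
  Υ⇒CosetForm {T} (_ , e₁ , e₂ , basis@(e₁≢ε , _) , y , _ , T↭) = e₁ , record
    { c        = e₂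
    ; e≢ε      = e₁≢ε
    ; count-e  = begin
        count m e₁ T                                          ≡⟨ count-↭ T↭ ⟩
        count m e₁ (replicate (m ∸ 1) e₁ ++ map F (allFin m)) ≡⟨ count-replicate-++ (m ∸ 1) e₁ _ ⟩
        m ∸ 1 + count m e₁ (map F (allFin m))                 ≡⟨ cong (m ∸ 1 +_) (∉⇒count≡0 e₁∉map) ⟩
        m ∸ 1 + 0                                             ≡⟨ +-identityʳ (m ∸ 1) ⟩
        m ∸ 1                                                 ∎
    ; in-coset = in-coset
    }
    where
    open ≡-Reasoning
    F : Fin m → K m
    F ν = toℕ (y ν) · e₁ ∙ e₂

    e₁∉map : e₁ ∉ map F (allFin m)
    e₁∉map e₁∈ with ∈-map⁻ F e₁∈
    ... | ν , _ , e₁≡Fν = second∉⟨first⟩ basis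
            (subst (λ z → _∈⟨_⟩ m z e₁) (sym (y≈x\\z _ e₂ e₁ (sym e₁≡Fν)))
              (∈⟨⟩-∙ (∈⟨⟩-⁻¹ (toℕ (y ν) , refl)) x∈⟨x⟩))

    in-coset : ∀ {x} → x ∈ T → x ≢ e₁ → ∃[ k ] x ≡ k · e₁ ∙ e₂
    in-coset x∈T x≢e₁ with ∈-++⁻ (replicate (m ∸ 1) e₁) (∈-resp-↭ T↭ x∈T)
    ... | inj₁ x∈e₁s = ⊥-elim (x≢e₁ (All.lookup (replicate⁺ {P = _≡ e₁} (m ∸ 1) refl) x∈e₁s))
    ... | inj₂ x∈map with ∈-map⁻ F x∈map
    ...   | ν , _ , x≡Fν = toℕ (y ν) , x≡Fν

  open CosetForm

  step-within-coset : ∀ {T e x g} → CosetForm T e → x ∈ T → x ≢ e → x ∙ g ∈ T → x ∙ g ≢ e → _∈⟨_⟩ m g e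
  step-within-coset {e = e} form x∈T x≢e xg∈T xg≢e with in-coset form x∈T x≢e | in-coset form xg∈T xg≢e
  ... | k , x≡ | j , xg≡ =
    subst (λ z → _∈⟨_⟩ m z e) (sym (coset-difference x≡ xg≡)) (∈⟨⟩-∙ (∈⟨⟩-⁻¹ (k , refl)) (j , refl))

module Items (n : ℕ) where

  -- m ≥ 4 is encoded as m = 4 + n, so that m ∸ 1, m ∸ 2 and m ∸ 3 compute.
  private
    m : ℕ
    m = 4 + n

  open KGroup m
  open KSequences m
  open CosetForm
  open AbelianGroupProperties abelianGroup
    using (identityʳ-unique; identityˡ-unique; y≈x\\z; ∙-cancelˡ; ε⁻¹≈ε; ⁻¹-anti-homo-\\; \\-leftDividesˡ; \\-leftDividesʳ)
  open AbelianGroup abelianGroup using (identityˡ; identityʳ; inverseʳ)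
  open Division group

  S : K m → K m → Seq m
  S f₁ f₂ = replicate (m ∸ 1) f₁ ++ replicate (m ∸ 1) f₂ ++ [ f₁ ∙ f₂ ]

  S₁ S₂ S₃ S₄ S₅ : K m → K m → K m → Seq m
  S₁ f₁ f₂ g = replicate (m ∸ 3) f₁ ++ replicate (m ∸ 1) f₂ ++ (f₁ ∙ f₂ ∷ f₁ ∙ g ∷ f₁ - g ∷ [])
  S₂ f₁ f₂ g = replicate (m ∸ 1) f₁ ++ replicate (m ∸ 3) f₂ ++ (f₁ ∙ f₂ ∷ f₂ ∙ g ∷ f₂ - g ∷ [])
  S₃ f₁ f₂ g = replicate (m ∸ 2) f₁ ++ replicate (m ∸ 2) f₂ ++ (f₁ ∙ f₂ ∷ f₁ ∙ g ∷ f₂ - g ∷ [])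
  S₄ f₁ f₂ g = replicate (m ∸ 2) f₁ ++ replicate (m ∸ 1) f₂ ++ (f₁ ∙ g ∷ f₁ ∙ f₂ - g ∷ [])
  S₅ f₁ f₂ g = replicate (m ∸ 1) f₁ ++ replicate (m ∸ 2) f₂ ++ (f₂ ∙ g ∷ f₁ ∙ f₂ - g ∷ [])

  record DistinctNonzero (f₁ f₂ : K m) : Set where
    field
      f₁≢f₂ : f₁ ≢ f₂
      f₁≢ε  : f₁ ≢ ε
      f₂≢ε  : f₂ ≢ ε

  open DistinctNonzero

  DistinctNonzero-sym : ∀ {f₁ f₂} → DistinctNonzero f₁ f₂ → DistinctNonzero f₂ f₁
  DistinctNonzero-sym d = record { f₁≢f₂ = ≢-sym (f₁≢f₂ d) ; f₁≢ε = f₂≢ε d ; f₂≢ε = f₁≢ε d }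

  distinctNonzero : ∀ {f₁ f₂} → ∃ (CosetForm (S f₁ f₂)) → DistinctNonzero f₁ f₂
  distinctNonzero {f₁} {f₂} (e , form) with _≟K_ m f₁ e | _≟K_ m f₂ e
  ... | yes refl | yes refl = ⊥-elim (1+n≢0 (+-cancelˡ-≡ (m ∸ 1) _ 0 (begin
    m ∸ 1 + (m ∸ 1 + count m f₁ [ f₁ ∙ f₁ ])    ≡⟨ cong (m ∸ 1 +_) (count-replicate-++ (m ∸ 1) f₁ _) ⟨
    m ∸ 1 + count m f₁ (replicate (m ∸ 1) f₁ ++ [ f₁ ∙ f₁ ]) ≡⟨ count-replicate-++ (m ∸ 1) f₁ _ ⟨
    count m f₁ (S f₁ f₁)                        ≡⟨ count-e form ⟩
    m ∸ 1                                       ≡⟨ +-identityʳ (m ∸ 1) ⟨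
    m ∸ 1 + 0                                   ∎)))
    where open ≡-Reasoning
  ... | yes refl | no f₂≢f₁ = record
    { f₁≢f₂ = ≢-sym f₂≢f₁
    ; f₁≢ε  = e≢ε form
    ; f₂≢ε  = λ f₂≡ε → count≡0⇒∉ (count-in-first-block (m ∸ 1) (m ∸ 1) 0 f₂≢f₁ (count-e form))
                (here (sym (trans (cong (f₁ ∙_) f₂≡ε) (identityʳ f₁))))
    }
  ... | no f₁≢f₂ | yes refl = record
    { f₁≢f₂ = f₁≢f₂
    ; f₁≢ε  = λ f₁≡ε → count≡0⇒∉ (count-in-second-block (m ∸ 1) (m ∸ 1) 0 f₁≢f₂ (count-e form))
                (here (sym (trans (cong (_∙ f₂) f₁≡ε) (identityˡ f₂))))
    ; f₂≢ε  = e≢ε form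
    }
  ... | no f₁≢e | no f₂≢e = ⊥-elim (≤⇒≯ count≤1 (s≤s (s≤s z≤n)))
    where
    count≤1 : m ∸ 1 ≤ 1
    count≤1 = subst (_≤ 1) (count-outside-blocks (m ∸ 1) (m ∸ 1) f₁≢e f₂≢e (count-e form)) (count≤length e [ f₁ ∙ f₂ ])

  item₁ : ∀ {f₁ f₂ g} → DistinctNonzero f₁ f₂ → ∃ (CosetForm (S₁ f₁ f₂ g)) → _∈⟨_⟩ m g f₂
  item₁ {f₁} {f₂} {g} d (e , form) with _≟K_ m f₁ e | _≟K_ m f₂ e
  ... | yes refl | yes refl = ⊥-elim (f₁≢f₂ d refl)
  ... | yes refl | no f₂≢f₁ = f₁∈tail (count≡suc⇒∈ (count-in-first-block (m ∸ 3) (m ∸ 1) 2 f₂≢f₁ (count-e form)))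
    where
    f₁∈tail : f₁ ∈ (f₁ ∙ f₂ ∷ f₁ ∙ g ∷ f₁ - g ∷ []) → _∈⟨_⟩ m g f₂
    f₁∈tail (here f₁≡f₁∙f₂)                = ⊥-elim (f₂≢ε d (identityʳ-unique f₁ f₂ (sym f₁≡f₁∙f₂)))
    f₁∈tail (there (here f₁≡f₁∙g))         =
      subst (λ z → _∈⟨_⟩ m z f₂) (sym (identityʳ-unique f₁ g (sym f₁≡f₁∙g))) ε∈⟨⟩
    f₁∈tail (there (there (here f₁≡f₁-g))) =
      subst (λ z → _∈⟨_⟩ m z f₂) (sym (x≈x//y⇒y≈ε f₁≡f₁-g)) ε∈⟨⟩
  ... | no f₁≢f₂ | yes refl =
    step-within-coset form (here refl) f₁≢f₂ (∈-beyond-blocks (m ∸ 3) (m ∸ 1) (there (here refl)))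
      (λ f₁∙g≡f₂ → f₂∉tail (there (here (sym f₁∙g≡f₂))))
    where
    f₂∉tail : f₂ ∉ (f₁ ∙ f₂ ∷ f₁ ∙ g ∷ f₁ - g ∷ [])
    f₂∉tail = count≡0⇒∉ (count-in-second-block (m ∸ 3) (m ∸ 1) 0 f₁≢f₂ (count-e form))
  ... | no f₁≢e | no f₂≢e = all≡e (count≥length⇒All≡ three≤count)
    where
    three≤count : 3 ≤ count m e (f₁ ∙ f₂ ∷ f₁ ∙ g ∷ f₁ - g ∷ [])
    three≤count = subst (3 ≤_) (sym (count-outside-blocks (m ∸ 3) (m ∸ 1) f₁≢e f₂≢e (count-e form))) (m≤m+n 3 n)
    all≡e : All (_≡ e) (f₁ ∙ f₂ ∷ f₁ ∙ g ∷ f₁ - g ∷ []) → _∈⟨_⟩ m g f₂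
    all≡e (f₁∙f₂≡e ∷ f₁∙g≡e ∷ _) =
      subst (λ z → _∈⟨_⟩ m z f₂) (∙-cancelˡ f₁ f₂ g (trans f₁∙f₂≡e (sym f₁∙g≡e))) x∈⟨x⟩

  item₂ : ∀ {f₁ f₂ g} → DistinctNonzero f₁ f₂ → ∃ (CosetForm (S₂ f₁ f₂ g)) → _∈⟨_⟩ m g f₁
  item₂ {f₁} {f₂} {g} d (e , form) = item₁ (DistinctNonzero-sym d) (e , CosetForm-resp-↭ S₂↭S₁ form)
    where
    S₂↭S₁ : S₂ f₁ f₂ g ↭ S₁ f₂ f₁ g
    S₂↭S₁ = ↭-trans (shifts (replicate (m ∸ 1) f₁) (replicate (m ∸ 3) f₂))
              (↭-reflexive (cong (λ s → replicate (m ∸ 3) f₂ ++ replicate (m ∸ 1) f₁ ++ (s ∷ f₂ ∙ g ∷ f₂ - g ∷ []))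
                                 (∙-comm f₁ f₂)))

  item₃ : ∀ {f₁ f₂ g} → DistinctNonzero f₁ f₂ → ∃ (CosetForm (S₃ f₁ f₂ g)) → g ≡ ε ⊎ g ≡ f₁ ⁻¹ ∙ f₂
  item₃ {f₁} {f₂} {g} d (e , form) with _≟K_ m f₁ e | _≟K_ m f₂ e
  ... | yes refl | yes refl = ⊥-elim (f₁≢f₂ d refl)
  ... | yes refl | no f₂≢f₁ = f₁∈tail (count≡suc⇒∈ (count-in-first-block (m ∸ 2) (m ∸ 2) 1 f₂≢f₁ (count-e form)))
    where
    f₁∈tail : f₁ ∈ (f₁ ∙ f₂ ∷ f₁ ∙ g ∷ f₂ - g ∷ []) → g ≡ ε ⊎ g ≡ f₁ ⁻¹ ∙ f₂
    f₁∈tail (here f₁≡f₁∙f₂)                = ⊥-elim (f₂≢ε d (identityʳ-unique f₁ f₂ (sym f₁≡f₁∙f₂)))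
    f₁∈tail (there (here f₁≡f₁∙g))         = inj₁ (identityʳ-unique f₁ g (sym f₁≡f₁∙g))
    f₁∈tail (there (there (here f₁≡f₂-g))) = inj₂ (x≈z//y⇒y≈x\\z f₁≡f₂-g)
  ... | no f₁≢f₂ | yes refl = f₂∈tail (count≡suc⇒∈ (count-in-second-block (m ∸ 2) (m ∸ 2) 1 f₁≢f₂ (count-e form)))
    where
    f₂∈tail : f₂ ∈ (f₁ ∙ f₂ ∷ f₁ ∙ g ∷ f₂ - g ∷ []) → g ≡ ε ⊎ g ≡ f₁ ⁻¹ ∙ f₂
    f₂∈tail (here f₂≡f₁∙f₂)                = ⊥-elim (f₁≢ε d (identityˡ-unique f₁ f₂ (sym f₂≡f₁∙f₂)))
    f₂∈tail (there (here f₂≡f₁∙g))         = inj₂ (y≈x\\z f₁ g f₂ (sym f₂≡f₁∙g))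
    f₂∈tail (there (there (here f₂≡f₂-g))) = inj₁ (x≈x//y⇒y≈ε f₂≡f₂-g)
  ... | no f₁≢e | no f₂≢e = all≡e (count≥length⇒All≡ three≤count)
    where
    three≤count : 3 ≤ count m e (f₁ ∙ f₂ ∷ f₁ ∙ g ∷ f₂ - g ∷ [])
    three≤count = subst (3 ≤_) (sym (count-outside-blocks (m ∸ 2) (m ∸ 2) f₁≢e f₂≢e (count-e form))) (m≤m+n 3 n)
    all≡e : All (_≡ e) (f₁ ∙ f₂ ∷ f₁ ∙ g ∷ f₂ - g ∷ []) → g ≡ ε ⊎ g ≡ f₁ ⁻¹ ∙ f₂
    all≡e (f₁∙f₂≡e ∷ f₁∙g≡e ∷ f₂-g≡e ∷ []) = ⊥-elim (e≢ε form (begin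
      e       ≡⟨ f₂-g≡e ⟨
      f₂ - g  ≡⟨ cong (f₂ -_) (∙-cancelˡ f₁ f₂ g (trans f₁∙f₂≡e (sym f₁∙g≡e))) ⟨
      f₂ - f₂ ≡⟨ inverseʳ f₂ ⟩
      ε       ∎))
      where open ≡-Reasoning

  S↭S₃ : ∀ {f₁ f₂ g} → g ≡ ε ⊎ g ≡ f₁ ⁻¹ ∙ f₂ → S f₁ f₂ ↭ S₃ f₁ f₂ g
  S↭S₃ {f₁} {f₂} (inj₁ refl) = ↭-trans (↭-heads-to-end f₁s f₂s (f₁ ∙ f₂) f₁ f₂)
    (↭-reflexive (cong₂ (λ u v → f₁s ++ f₂s ++ (f₁ ∙ f₂ ∷ u ∷ v ∷ [])) (sym (identityʳ f₁)) (sym f₂-ε≡f₂)))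
    where
    f₁s = replicate (m ∸ 2) f₁
    f₂s = replicate (m ∸ 2) f₂
    f₂-ε≡f₂ : f₂ - ε ≡ f₂
    f₂-ε≡f₂ = trans (cong (f₂ ∙_) ε⁻¹≈ε) (identityʳ f₂)
  S↭S₃ {f₁} {f₂} (inj₂ refl) = ↭-trans (↭-heads-to-end f₁s f₂s (f₁ ∙ f₂) f₁ f₂)
    (↭-trans (++⁺ˡ f₁s (++⁺ˡ f₂s (prep (f₁ ∙ f₂) (swap f₁ f₂ ↭-refl))))
      (↭-reflexive (cong₂ (λ u v → f₁s ++ f₂s ++ (f₁ ∙ f₂ ∷ u ∷ v ∷ []))
                          (sym (\\-leftDividesˡ f₁ f₂)) (sym f₂-[f₁⁻¹∙f₂]≡f₁))))
    where
    f₁s = replicate (m ∸ 2) f₁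
    f₂s = replicate (m ∸ 2) f₂
    f₂-[f₁⁻¹∙f₂]≡f₁ : f₂ - (f₁ ⁻¹ ∙ f₂) ≡ f₁
    f₂-[f₁⁻¹∙f₂]≡f₁ = trans (cong (f₂ ∙_) (⁻¹-anti-homo-\\ f₁ f₂)) (\\-leftDividesˡ f₂ f₁)

  item₄ : ∀ {f₁ f₂ g} → DistinctNonzero f₁ f₂ → ∃ (CosetForm (S₄ f₁ f₂ g)) → _∈⟨_⟩ m g f₂
  item₄ {f₁} {f₂} {g} d (e , form) with _≟K_ m f₁ e | _≟K_ m f₂ e
  ... | yes refl | yes refl = ⊥-elim (f₁≢f₂ d refl)
  ... | yes refl | no f₂≢f₁ = f₁∈tail (count≡suc⇒∈ (count-in-first-block (m ∸ 2) (m ∸ 1) 1 f₂≢f₁ (count-e form)))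
    where
    f₁∈tail : f₁ ∈ (f₁ ∙ g ∷ f₁ ∙ f₂ - g ∷ []) → _∈⟨_⟩ m g f₂
    f₁∈tail (here f₁≡f₁∙g)            =
      subst (λ z → _∈⟨_⟩ m z f₂) (sym (identityʳ-unique f₁ g (sym f₁≡f₁∙g))) ε∈⟨⟩
    f₁∈tail (there (here f₁≡f₁∙f₂-g)) =
      subst (λ z → _∈⟨_⟩ m z f₂) (sym (trans (x≈z//y⇒y≈x\\z f₁≡f₁∙f₂-g) (\\-leftDividesʳ f₁ f₂))) x∈⟨x⟩
  ... | no f₁≢f₂ | yes refl =
    step-within-coset form (here refl) f₁≢f₂ (∈-beyond-blocks (m ∸ 2) (m ∸ 1) (here refl))
      (λ f₁∙g≡f₂ → f₂∉tail (here (sym f₁∙g≡f₂)))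
    where
    f₂∉tail : f₂ ∉ (f₁ ∙ g ∷ f₁ ∙ f₂ - g ∷ [])
    f₂∉tail = count≡0⇒∉ (count-in-second-block (m ∸ 2) (m ∸ 1) 0 f₁≢f₂ (count-e form))
  ... | no f₁≢e | no f₂≢e = ⊥-elim (≤⇒≯ count≤2 (m≤m+n 3 n))
    where
    count≤2 : m ∸ 1 ≤ 2
    count≤2 = subst (_≤ 2) (count-outside-blocks (m ∸ 2) (m ∸ 1) f₁≢e f₂≢e (count-e form))
                (count≤length e (f₁ ∙ g ∷ f₁ ∙ f₂ - g ∷ []))

  item₅ : ∀ {f₁ f₂ g} → DistinctNonzero f₁ f₂ → ∃ (CosetForm (S₅ f₁ f₂ g)) → _∈⟨_⟩ m g f₁
  item₅ {f₁} {f₂} {g} d (e , form) = item₄ (DistinctNonzero-sym d) (e , CosetForm-resp-↭ S₅↭S₄ form)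
    where
    S₅↭S₄ : S₅ f₁ f₂ g ↭ S₄ f₂ f₁ g
    S₅↭S₄ = ↭-trans (shifts (replicate (m ∸ 1) f₁) (replicate (m ∸ 2) f₂))
              (↭-reflexive (cong (λ s → replicate (m ∸ 2) f₂ ++ replicate (m ∸ 1) f₁ ++ (f₂ ∙ g ∷ s - g ∷ []))
                                 (∙-comm f₁ f₂)))

lemma3p2 : (m : ℕ) .{{_ : NonZero m}} → 4 ≤ m → (g f1 f2 : K m) →
    Υnu m (replicate (m ∸ 1) f1 ++ replicate (m ∸ 1) f2 ++ (_+K_ m f1 f2 ∷ [])) →
    (Υ m (replicate (m ∸ 3) f1 ++ replicate (m ∸ 1) f2 ++ (_+K_ m f1 f2 ∷ _+K_ m f1 g ∷ _-K_ m f1 g ∷ []))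
      → _∈⟨_⟩ m g f2)
    × (Υ m (replicate (m ∸ 1) f1 ++ replicate (m ∸ 3) f2 ++ (_+K_ m f1 f2 ∷ _+K_ m f2 g ∷ _-K_ m f2 g ∷ []))
      → _∈⟨_⟩ m g f1)
    × (Υ m (replicate (m ∸ 2) f1 ++ replicate (m ∸ 2) f2 ++ (_+K_ m f1 f2 ∷ _+K_ m f1 g ∷ _-K_ m f2 g ∷ []))
      → ((replicate (m ∸ 1) f1 ++ replicate (m ∸ 1) f2 ++ (_+K_ m f1 f2 ∷ []))
           ↭ (replicate (m ∸ 2) f1 ++ replicate (m ∸ 2) f2 ++ (_+K_ m f1 f2 ∷ _+K_ m f1 g ∷ _-K_ m f2 g ∷ [])))
        × (g ≡ 0K m ⊎ g ≡ _+K_ m (-K_ m f1) f2))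
    × (Υ m (replicate (m ∸ 2) f1 ++ replicate (m ∸ 1) f2 ++ (_+K_ m f1 g ∷ _-K_ m (_+K_ m f1 f2) g ∷ []))
      → _∈⟨_⟩ m g f2)
    × (Υ m (replicate (m ∸ 1) f1 ++ replicate (m ∸ 2) f2 ++ (_+K_ m f2 g ∷ _-K_ m (_+K_ m f1 f2) g ∷ []))
      → _∈⟨_⟩ m g f1)
lemma3p2 _ (s≤s (s≤s (s≤s (s≤s {n = n} z≤n)))) g f1 f2 (ΥS , _) =
    item₁ d ∘ Υ⇒CosetForm
  , item₂ d ∘ Υ⇒CosetForm
  , < S↭S₃ , id > ∘ item₃ d ∘ Υ⇒CosetForm
  , item₄ d ∘ Υ⇒CosetForm
  , item₅ d ∘ Υ⇒CosetForm
  where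
  open Items n
  open KSequences (4 + n) using (Υ⇒CosetForm)
  d : DistinctNonzero f1 f2
  d = distinctNonzero (Υ⇒CosetForm ΥS)
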